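{- Let $n$ be a positive integer and $\delta(n)=\min\{r+s\mid r,s\in\mathbb N_0,\ r\le s,\ rs=n\}$. In what follows, $p$ always denotes a prime number. Then: (i) $\delta(n)\le\frac{n+4}2$ iff $n$ is not an odd prime. (ii) $\delta(n)=\frac{n+4}2$ iff $n\in\{2,4,6,8,10,14\}$ or $n=2p$ with $p\ge 11$. (iii) $\delta(n)\le\frac{n+3}2$ iff $n\ne 8$ and $n\ne p,2p$ for every $p$. (iv) $\delta(n)=\frac{n+3}2$ iff $n\in\{1,9\}$. (v) $\delta(n)\le\frac{n+2}2$ iff $n\notin\{1,8,9\}$ and $n\ne p,2p$ for every $p$. (vi) $\delta(n)=\frac{n+2}2$ iff $n=12$. (vii) $\delta(n)\le\frac{n+1}2$ iff $n\notin\{1,8,9,12\}$ and $n\ne p,2p$ for every $p$. (viii) $\delta(n)=\frac{n+1}2$ iff $n=15$. (ix) $\delta(n)\le\frac{n}2$ iff $n\notin\{1,8,9,12,15\}$ and $n\ne p,2p$ for every $p$. (x) $\delta(n)=\frac n2$ iff $n\in\{16,18\}$. (xi) $\delta(n)\le\frac{n-1}2$ iff $n\ge 20$ and $n\ne p,2p$ for every $p\ge 11$. (xii) $\delta(n)=\frac{n-1}2$ iff $n=21$. (xiii) $\delta(n)\le\frac{n-2}2$ iff $n\ge 20$, $n\ne 21$, and $n\ne p,2p$ for every $p\ge 11$. (xiv) $\delta(n)=\frac{n-2}2$ iff $n=20$. (xv) $\delta(n)\le\frac{n-3}2$ iff $n\ge 24$ and $n\ne p,2p$ for every $p\ge 13$.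 (xvi) $\delta(n)=\frac{n-3}2$ iff $n=27$. (xvii) $\delta(n)\le\frac{n-4}2$ iff $n\ge 24$, $n\ne 27$, and $n\ne p,2p$ for every $p\ge 13$. (xviii) $\delta(n)=\frac{n-4}2$ iff $n=24$.
   Context: $\mathbb N_0$ denotes the set of non-negative integers. -}

module Defs where

open import Data.Nat using (ℕ; _+_; _*_; _≤_)
open import Data.Product using (Σ; ∃; _×_)
open import Relation.Binary.PropositionalEquality using (_≡_)

Admissible : ℕ → ℕ → ℕ → Set
Admissible n r s = r ≤ s × r * s ≡ n

IsDelta : ℕ → ℕ → Set
IsDelta n d =
  (∃ λ r → ∃ λ s → Admissible n r s × r + s ≡ d) ×
  (∀ r s → Admissible n r s → d ≤ r + s)

-- Write δ(n) = r + s for a minimal admissible pair (r , s), so n = r s.  Since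
-- r s + 4 = 2 (r + s) + (r − 2)(s − 2), the quantity n + 4 − 2 δ(n) is governed by r:
-- for r = 1, n is 1 or a prime and 2 δ(n) = 2 n + 2; for r = 2, minimality forces s to be
-- prime (or n = 8) and 2 δ(n) = n + 4; for r ≥ 3, n is neither a prime nor twice a prime and
-- n + 4 − 2 δ(n) = (r − 2)(s − 2), which is at least 9 as soon as n ≥ 28 (the pair (3 , 10)
-- is beaten by (5 , 6)).  So for n ≥ 28 every clause is settled by which of the three cases
-- n falls in, while the finitely many n < 28 are checked by computation.
module Submission where

open import Defs
open import Data.Bool using (T)
open import Data.Empty using (⊥; ⊥-elim)
open import Data.Nat
  using (ℕ; suc; _+_; _*_; _≤_; _<_; _≰_; _≤ᵇ_; _<ᵇ_; z≤n; s≤s; 2+; n>1⇒nonTrivial; nonTrivial⇒n>1)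
open import Data.Nat.Divisibility using (_∣_; _∣?_; divides; m∣m*n)
open import Data.Nat.Primality
  using (Prime; prime; prime?; composite; prime[2]; prime⇒irreducible; euclidsLemma)
open import Data.Nat.Properties
open import Data.Nat.Tactic.RingSolver using (solve-∀)
open import Data.Product using (Σ; ∃; _×_; _,_; proj₁; proj₂)
open import Data.Sum using (_⊎_; inj₁; inj₂; [_,_]′)
open import Function using (_∘_)
open import Function.Bundles using (_⇔_; mk⇔; Equivalence)
open import Relation.Binary.PropositionalEquality using (_≡_; _≢_; refl; sym; trans; cong; subst)
open import Relation.Nullary using (¬_; Dec; yes; no; ¬?; contradiction)
open import Relation.Nullary.Decidable using (map′; _×-dec_; _⊎-dec_; _→-dec_; from-yes; from-no)
open import Relation.Unary using (Pred; Decidable)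

DeltaThresholds : ℕ → ℕ → Set
DeltaThresholds n d =
    (2 * d ≤ n + 4 ⇔ (¬ (Prime n × ¬ (2 ∣ n)))) ×
    (2 * d ≡ n + 4 ⇔
      (n ≡ 2 ⊎ n ≡ 4 ⊎ n ≡ 6 ⊎ n ≡ 8 ⊎ n ≡ 10 ⊎ n ≡ 14 ⊎
       (Σ ℕ λ p → Prime p × 11 ≤ p × n ≡ 2 * p))) ×
    (2 * d ≤ n + 3 ⇔ (n ≢ 8 × (∀ p → Prime p → n ≢ p × n ≢ 2 * p))) ×
    (2 * d ≡ n + 3 ⇔ (n ≡ 1 ⊎ n ≡ 9)) ×
    (2 * d ≤ n + 2 ⇔
      (n ≢ 1 × n ≢ 8 × n ≢ 9 × (∀ p → Prime p → n ≢ p × n ≢ 2 * p))) ×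
    (2 * d ≡ n + 2 ⇔ (n ≡ 12)) ×
    (2 * d ≤ n + 1 ⇔
      (n ≢ 1 × n ≢ 8 × n ≢ 9 × n ≢ 12 × (∀ p → Prime p → n ≢ p × n ≢ 2 * p))) ×
    (2 * d ≡ n + 1 ⇔ (n ≡ 15)) ×
    (2 * d ≤ n ⇔
      (n ≢ 1 × n ≢ 8 × n ≢ 9 × n ≢ 12 × n ≢ 15 ×
       (∀ p → Prime p → n ≢ p × n ≢ 2 * p))) ×
    (2 * d ≡ n ⇔ (n ≡ 16 ⊎ n ≡ 18)) ×
    (2 * d + 1 ≤ n ⇔
      (20 ≤ n × (∀ p → Prime p → 11 ≤ p → n ≢ p × n ≢ 2 * p))) ×
    (2 * d + 1 ≡ n ⇔ (n ≡ 21)) ×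
    (2 * d + 2 ≤ n ⇔
      (20 ≤ n × n ≢ 21 × (∀ p → Prime p → 11 ≤ p → n ≢ p × n ≢ 2 * p))) ×
    (2 * d + 2 ≡ n ⇔ (n ≡ 20)) ×
    (2 * d + 3 ≤ n ⇔
      (24 ≤ n × (∀ p → Prime p → 13 ≤ p → n ≢ p × n ≢ 2 * p))) ×
    (2 * d + 3 ≡ n ⇔ (n ≡ 27)) ×
    (2 * d + 4 ≤ n ⇔
      (24 ≤ n × n ≢ 27 × (∀ p → Prime p → 13 ≤ p → n ≢ p × n ≢ 2 * p))) ×
    (2 * d + 4 ≡ n ⇔ (n ≡ 24))

isDelta-≤ : ∀ {n d} → IsDelta n d → ∀ a b → a * b ≡ n → d ≤ a + b
isDelta-≤ {d = d} (_ , minimal) a b ab≡n with ≤-total a b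
... | inj₁ a≤b = minimal a b (a≤b , ab≡n)
... | inj₂ b≤a = subst (d ≤_) (+-comm b a) (minimal b a (b≤a , trans (*-comm b a) ab≡n))

-- Deciding the clauses for given n and δ(n)

infix 0 _⇔?_
_⇔?_ : ∀ {a b} {A : Set a} {B : Set b} → Dec A → Dec B → Dec (A ⇔ B)
a? ⇔? b? = map′ (λ (f , g) → mk⇔ f g) (λ e → Equivalence.to e , Equivalence.from e)
                ((a? →-dec b?) ×-dec (b? →-dec a?))

module _ {ℓ} {P : Pred ℕ ℓ} (P? : Decidable P) where

  all?-beyond : ∀ v → (∀ {n} → v ≤ n → P n) → Dec (∀ n → P n)
  all?-beyond v P≥v = map′ extend (λ ∀P {n} _ → ∀P n) (allUpTo? P? v)
    where
    extend : (∀ {n} → n < v → P n) → ∀ n → P n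
    extend P<v n with n <? v
    ... | yes n<v = P<v n<v
    ... | no  n≮v = P≥v (≮⇒≥ n≮v)

  any?-below : ∀ v → (∀ {n} → P n → n < v) → Dec (∃ P)
  any?-below v P⇒<v =
    map′ (λ (n , _ , Pn) → n , Pn) (λ (n , Pn) → n , P⇒<v Pn , Pn) (anyUpTo? P? v)

twicePrime? : ∀ b n → Dec (Σ ℕ λ p → Prime p × b ≤ p × n ≡ 2 * p)
twicePrime? b n = any?-below (λ p → prime? p ×-dec b ≤? p ×-dec n ≟ 2 * p) (suc n)
  λ { {p} (_ , _ , refl) → s≤s (m≤n*m p 2) }

noPrimeAbove? : ∀ b n → Dec (∀ p → Prime p → b ≤ p → n ≢ p × n ≢ 2 * p)
noPrimeAbove? b n =
  all?-beyond (λ p → prime? p →-dec b ≤? p →-dec ¬? (n ≟ p) ×-dec ¬? (n ≟ 2 * p)) (suc n)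
    λ {p} n<p _ _ → <⇒≢ n<p , <⇒≢ (≤-trans n<p (m≤n*m p 2))

noPrime? : ∀ n → Dec (∀ p → Prime p → n ≢ p × n ≢ 2 * p)
noPrime? n = map′ (λ h p pp → h p pp z≤n) (λ h p pp _ → h p pp) (noPrimeAbove? 0 n)

deltaThresholds? : ∀ n d → Dec (DeltaThresholds n d)
deltaThresholds? n d =
  (2 * d ≤? n + 4 ⇔? ¬? (prime? n ×-dec ¬? (2 ∣? n))) ×-dec
  (2 * d ≟ n + 4 ⇔? n ≟ 2 ⊎-dec n ≟ 4 ⊎-dec n ≟ 6 ⊎-dec n ≟ 8 ⊎-dec n ≟ 10 ⊎-dec n ≟ 14 ⊎-dec
                    twicePrime? 11 n) ×-dec
  (2 * d ≤? n + 3 ⇔? ¬? (n ≟ 8) ×-dec noPrime? n) ×-dec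
  (2 * d ≟ n + 3 ⇔? n ≟ 1 ⊎-dec n ≟ 9) ×-dec
  (2 * d ≤? n + 2 ⇔? ¬? (n ≟ 1) ×-dec ¬? (n ≟ 8) ×-dec ¬? (n ≟ 9) ×-dec noPrime? n) ×-dec
  (2 * d ≟ n + 2 ⇔? n ≟ 12) ×-dec
  (2 * d ≤? n + 1 ⇔? ¬? (n ≟ 1) ×-dec ¬? (n ≟ 8) ×-dec ¬? (n ≟ 9) ×-dec ¬? (n ≟ 12) ×-dec
                     noPrime? n) ×-dec
  (2 * d ≟ n + 1 ⇔? n ≟ 15) ×-dec
  (2 * d ≤? n ⇔? ¬? (n ≟ 1) ×-dec ¬? (n ≟ 8) ×-dec ¬? (n ≟ 9) ×-dec ¬? (n ≟ 12) ×-dec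
                 ¬? (n ≟ 15) ×-dec noPrime? n) ×-dec
  (2 * d ≟ n ⇔? n ≟ 16 ⊎-dec n ≟ 18) ×-dec
  (2 * d + 1 ≤? n ⇔? 20 ≤? n ×-dec noPrimeAbove? 11 n) ×-dec
  (2 * d + 1 ≟ n ⇔? n ≟ 21) ×-dec
  (2 * d + 2 ≤? n ⇔? 20 ≤? n ×-dec ¬? (n ≟ 21) ×-dec noPrimeAbove? 11 n) ×-dec
  (2 * d + 2 ≟ n ⇔? n ≟ 20) ×-dec
  (2 * d + 3 ≤? n ⇔? 24 ≤? n ×-dec noPrimeAbove? 13 n) ×-dec
  (2 * d + 3 ≟ n ⇔? n ≟ 27) ×-dec
  (2 * d + 4 ≤? n ⇔? 24 ≤? n ×-dec ¬? (n ≟ 27) ×-dec noPrimeAbove? 13 n) ×-dec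
  (2 * d + 4 ≟ n ⇔? n ≟ 24)

admissible? : ∀ n r s → Dec (Admissible n r s)
admissible? n r s = r ≤? s ×-dec r * s ≟ n

admissible⇒≤ : ∀ {n r s} → 1 ≤ n → Admissible n r s → r ≤ n × s ≤ n
admissible⇒≤ {r = 0}                   1≤n (_ , refl) = contradiction 1≤n λ ()
admissible⇒≤ {r = suc _} {s = 0}       _   (() , _)
admissible⇒≤ {r = r@(suc _)} {s@(suc _)} _ (_ , refl) = m≤m*n r s , m≤n*m s r

MinimalUpTo : ℕ → ℕ → ℕ → Set
MinimalUpTo n r s =
  ∀ {r′} → r′ < suc n → ∀ {s′} → s′ < suc n → Admissible n r′ s′ → r + s ≤ r′ + s′

minimalUpTo? : ∀ n r s → Dec (MinimalUpTo n r s)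
minimalUpTo? n r s =
  allUpTo? (λ r′ → allUpTo? (λ s′ → admissible? n r′ s′ →-dec r + s ≤? r′ + s′) (suc n)) (suc n)

deltaThresholds-small : ∀ {n} → n < 28 → 1 ≤ n → ∀ {r} → r < suc n → ∀ {s} → s < suc n →
  Admissible n r s → MinimalUpTo n r s → DeltaThresholds n (r + s)
deltaThresholds-small = from-yes (allUpTo? (λ n → 1 ≤? n →-dec allUpTo? (λ r → allUpTo? (λ s →
  admissible? n r s →-dec minimalUpTo? n r s →-dec deltaThresholds? n (r + s)) (suc n)) (suc n)) 28)

a+b≤a*b : ∀ {a b} → 2 ≤ a → 2 ≤ b → a + b ≤ a * b
a+b≤a*b {2+ x} {2+ y} (s≤s (s≤s _)) (s≤s (s≤s _)) =
  ≤-trans (m≤m+n _ (x + y + x * y)) (≤-reflexive (expand x y))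
  where
  expand : ∀ x y → 2 + x + (2 + y) + (x + y + x * y) ≡ (2 + x) * (2 + y)
  expand = solve-∀

2*a+b<2+a*b : ∀ {a b} → 2 ≤ a → 3 ≤ b → 2 * a + b < 2 + a * b
2*a+b<2+a*b {2+ x} {suc (2+ y)} (s≤s (s≤s _)) (s≤s (s≤s (s≤s _))) =
  ≤-trans (s≤s (m≤m+n _ (x + y + x * y))) (≤-reflexive (expand x y))
  where
  expand : ∀ x y → suc (2 * (2 + x) + (3 + y) + (x + y + x * y)) ≡ 2 + (2 + x) * (3 + y)
  expand = solve-∀

unfactorable⇒prime : ∀ {n} → 2 ≤ n → (∀ {a b} → 2 ≤ a → 2 ≤ b → a * b ≢ n) → Prime n
unfactorable⇒prime {n} 2≤n unfactorable =
  prime {{n>1⇒nonTrivial 2≤n}} λ (composite {a} a<n a∣n) → noCofactor (nonTrivial⇒n>1 a) a<n a∣n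
  where
  noCofactor : ∀ {a} → 2 ≤ a → a < n → a ∣ n → ⊥
  noCofactor _   _   (divides 0 n≡0)          = contradiction (subst (2 ≤_) n≡0 2≤n) λ ()
  noCofactor _   a<n (divides 1 n≡a+0)        = <⇒≢ a<n (sym (trans n≡a+0 (+-identityʳ _)))
  noCofactor 2≤a _   (divides q@(2+ _) n≡q*a) = unfactorable {q} (s≤s (s≤s z≤n)) 2≤a (sym n≡q*a)

product-¬prime : ∀ {a b} → 2 ≤ a → 2 ≤ b → ¬ Prime (a * b)
product-¬prime {a@(2+ _)} {b} (s≤s (s≤s _)) 2≤b pr with prime⇒irreducible pr (m∣m*n b)
... | inj₁ ()
... | inj₂ a≡a*b = <⇒≢ (m<m*n a b 2≤b) a≡a*b

evenProduct-≢twicePrime : ∀ {a b p} → 3 ≤ a → 2 ≤ b → 2 ∣ a → Prime p → a * b ≢ 2 * p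
evenProduct-≢twicePrime {b = b} {p} 3≤a 2≤b (divides q refl) pr q2b≡2p =
  product-¬prime (*-cancelʳ-< 2 1 q 3≤a) 2≤b (subst Prime (sym qb≡p) pr)
  where
  reassociate : ∀ q b → 2 * (q * b) ≡ q * 2 * b
  reassociate = solve-∀
  qb≡p : q * b ≡ p
  qb≡p = *-cancelˡ-≡ (q * b) p 2 (trans (reassociate q b) q2b≡2p)

product-≢twicePrime : ∀ {a b p} → 3 ≤ a → 3 ≤ b → Prime p → a * b ≢ 2 * p
product-≢twicePrime {a} {b} {p} 3≤a 3≤b pr ab≡2p
  with euclidsLemma a b prime[2] (divides p (trans ab≡2p (*-comm 2 p)))
... | inj₁ 2∣a = evenProduct-≢twicePrime 3≤a (≤-trans (n≤1+n 2) 3≤b) 2∣a pr ab≡2p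
... | inj₂ 2∣b =
  evenProduct-≢twicePrime 3≤b (≤-trans (n≤1+n 2) 3≤a) 2∣b pr (trans (*-comm b a) ab≡2p)

isDelta-1+n⇒prime : ∀ {n} → 2 ≤ n → IsDelta n (1 + n) → Prime n
isDelta-1+n⇒prime 2≤n isδ = unfactorable⇒prime 2≤n λ {a} {b} 2≤a 2≤b ab≡n →
  1+n≰n (≤-trans (isDelta-≤ isδ a b ab≡n) (≤-trans (a+b≤a*b 2≤a 2≤b) (≤-reflexive ab≡n)))

isDelta-2+n⇒prime : ∀ {n} → 5 ≤ n → IsDelta (2 * n) (2 + n) → Prime n
isDelta-2+n⇒prime {n} 5≤n isδ = unfactorable⇒prime (≤-trans (m≤m+n 2 3) 5≤n) unfactorable
  where
  doubled : ∀ {a b} → 2 ≤ a → 3 ≤ b → a * b ≢ n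
  doubled {a} {b} 2≤a 3≤b ab≡n = <-irrefl refl (begin-strict
    2 + n          ≤⟨ isDelta-≤ isδ (2 * a) b (trans (*-assoc 2 a b) (cong (2 *_) ab≡n)) ⟩
    2 * a + b      <⟨ 2*a+b<2+a*b 2≤a 3≤b ⟩
    2 + a * b      ≡⟨ cong (2 +_) ab≡n ⟩
    2 + n          ∎)
    where open ≤-Reasoning
  unfactorable : ∀ {a b} → 2 ≤ a → 2 ≤ b → a * b ≢ n
  unfactorable {a} {b} 2≤a 2≤b ab≡n with 3 ≤? b | 3 ≤? a
  ... | yes 3≤b | _       = doubled 2≤a 3≤b ab≡n
  ... | no  _   | yes 3≤a = doubled 2≤b 3≤a (trans (*-comm b a) ab≡n)
  ... | no  3≰b | no  3≰a =
    <⇒≱ 5≤n (≤-trans (≤-reflexive (sym ab≡n)) (*-mono-≤ (≤-pred (≰⇒> 3≰a)) (≤-pred (≰⇒> 3≰b))))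

excess-identity : ∀ a b → (2 + a) * (2 + b) + 4 ≡ 2 * ((2 + a) + (2 + b)) + a * b
excess-identity = solve-∀

9≤excess⇒below : ∀ a b → 9 ≤ a * b → 2 * ((2 + a) + (2 + b)) + 5 ≤ (2 + a) * (2 + b)
9≤excess⇒below a b 9≤ab = +-cancelʳ-≤ 4 _ _ (begin
  2 * (r + s) + 5 + 4    ≡⟨ +-assoc (2 * (r + s)) 5 4 ⟩
  2 * (r + s) + 9        ≤⟨ +-monoʳ-≤ (2 * (r + s)) 9≤ab ⟩
  2 * (r + s) + a * b    ≡⟨ excess-identity a b ⟨
  r * s + 4              ∎)
  where
  open ≤-Reasoning
  r s : ℕ
  r = 2 + a
  s = 2 + b

isDelta⇒9≤excess : ∀ {a b} → 1 ≤ a → a ≤ b → 28 ≤ (2 + a) * (2 + b) →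
  IsDelta ((2 + a) * (2 + b)) ((2 + a) + (2 + b)) → 9 ≤ a * b
isDelta⇒9≤excess {1} {b} _ _ large isδ = subst (9 ≤_) (sym (+-identityʳ b)) (≤∧≢⇒< 8≤b 8≢b)
  where
  8≤b : 8 ≤ b
  8≤b = ≤-pred (≤-pred (*-cancelˡ-< 3 9 (2 + b) large))
  8≢b : 8 ≢ b
  8≢b refl = contradiction (isDelta-≤ isδ 5 6 refl) (from-no (13 ≤? 11))
isDelta⇒9≤excess {2} {b} _ _ large _ = ≤-trans (n≤1+n 9) (*-monoʳ-≤ 2 5≤b)
  where
  5≤b : 5 ≤ b
  5≤b = ≤-pred (≤-pred (*-cancelˡ-< 4 6 (2 + b) (≤-trans (m≤m+n 25 3) large)))
isDelta⇒9≤excess {a@(suc (2+ _))} _ a≤b _ _ = *-mono-≤ 3≤a (≤-trans 3≤a a≤b)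
  where
  3≤a : 3 ≤ a
  3≤a = s≤s (s≤s (s≤s z≤n))

-- Large n

both : ∀ {a b} {A : Set a} {B : Set b} → A → B → A ⇔ B
both a b = mk⇔ (λ _ → b) (λ _ → a)

neither : ∀ {a b} {A : Set a} {B : Set b} → ¬ A → ¬ B → A ⇔ B
neither ¬a ¬b = mk⇔ (⊥-elim ∘ ¬a) (⊥-elim ∘ ¬b)

≰⇒≢ : ∀ {x y} → x ≰ y → x ≢ y
≰⇒≢ x≰y = x≰y ∘ ≤-reflexive

-- Side conditions between numerals, such as c < b, are implicit `T (c <ᵇ b)` arguments,
-- which evaluation discharges at every use.
≥⇒≢ : ∀ {n b} → b ≤ n → ∀ {c} → {T (c <ᵇ b)} → n ≢ c
≥⇒≢ {b = b} b≤n {c} {c<b} = >⇒≢ (<-≤-trans (<ᵇ⇒< c b c<b) b≤n)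

-- n is explicit since unification cannot recover it from n + c (and likewise x from x + c).
module _ {x c : ℕ} (n : ℕ) where

  above⇒≰+ : n + c ≤ x → ∀ {k} → {T (k <ᵇ c)} → x ≰ n + k
  above⇒≰+ n+c≤x {k} {k<c} = <⇒≱ (<-≤-trans (+-monoʳ-< n (<ᵇ⇒< k c k<c)) n+c≤x)

  above⇒≰ : n + c ≤ x → {T (0 <ᵇ c)} → x ≰ n
  above⇒≰ n+c≤x {0<c} x≤n =
    above⇒≰+ n+c≤x {0} {0<c} (≤-trans x≤n (≤-reflexive (sym (+-identityʳ n))))

  above⇒+≰ : n + c ≤ x → {T (0 <ᵇ c)} → ∀ {j} → x + j ≰ n
  above⇒+≰ n+c≤x {0<c} = above⇒≰ n+c≤x {0<c} ∘ m+n≤o⇒m≤o x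

module _ {n c : ℕ} (x : ℕ) where

  below⇒< : x + c ≤ n → {T (0 <ᵇ c)} → x < n
  below⇒< x+c≤n {0<c} = <-≤-trans (m<m+n x (<ᵇ⇒< 0 c 0<c)) x+c≤n

  below⇒≤+ : x + c ≤ n → ∀ {k} → x ≤ n + k
  below⇒≤+ x+c≤n {k} = ≤-trans (m+n≤o⇒m≤o x x+c≤n) (m≤m+n n k)

  below⇒≤ : x + c ≤ n → x ≤ n
  below⇒≤ = m+n≤o⇒m≤o x

  below⇒+≤ : x + c ≤ n → ∀ {j} → {T (j ≤ᵇ c)} → x + j ≤ n
  below⇒+≤ x+c≤n {j} {j≤c} = ≤-trans (+-monoʳ-≤ x (≤ᵇ⇒≤ j c j≤c)) x+c≤n

  below⇒≢+ : x + c ≤ n → {T (0 <ᵇ c)} → ∀ {k} → x ≢ n + k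
  below⇒≢+ x+c≤n {0<c} {k} = <⇒≢ (<-≤-trans (below⇒< x+c≤n {0<c}) (m≤m+n n k))

  below⇒≢ : x + c ≤ n → {T (0 <ᵇ c)} → x ≢ n
  below⇒≢ x+c≤n {0<c} = <⇒≢ (below⇒< x+c≤n {0<c})

  below⇒+≢ : x + c ≤ n → ∀ {j} → {T (j <ᵇ c)} → x + j ≢ n
  below⇒+≢ x+c≤n {j} {j<c} = <⇒≢ (<-≤-trans (+-monoʳ-< x (<ᵇ⇒< j c j<c)) x+c≤n)

deltaThresholds-oddPrime : ∀ {n} → 28 ≤ n → Prime n → ¬ 2 ∣ n → DeltaThresholds n (1 + n)
deltaThresholds-oddPrime {n} large pr odd =
  neither (above⇒≰+ n exceeds) (λ notOddPrime → notOddPrime (pr , odd)) ,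
  neither (≰⇒≢ (above⇒≰+ n exceeds))
    [ ≢small , [ ≢small , [ ≢small , [ ≢small , [ ≢small , [ ≢small , notTwice ]′ ]′ ]′ ]′ ]′ ]′ ,
  neither (above⇒≰+ n exceeds) (¬noPrime ∘ proj₂) ,
  neither (≰⇒≢ (above⇒≰+ n exceeds)) [ ≢small , ≢small ]′ ,
  neither (above⇒≰+ n exceeds) (λ (_ , _ , _ , h) → ¬noPrime h) ,
  neither (≰⇒≢ (above⇒≰+ n exceeds)) ≢small ,
  neither (above⇒≰+ n exceeds) (λ (_ , _ , _ , _ , h) → ¬noPrime h) ,
  neither (≰⇒≢ (above⇒≰+ n exceeds)) ≢small ,
  neither (above⇒≰ n exceeds) (λ (_ , _ , _ , _ , _ , h) → ¬noPrime h) ,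
  neither (≰⇒≢ (above⇒≰ n exceeds)) [ ≢small , ≢small ]′ ,
  neither (above⇒+≰ n exceeds) (¬noPrimeAbove ∘ proj₂) ,
  neither (≰⇒≢ (above⇒+≰ n exceeds)) ≢small ,
  neither (above⇒+≰ n exceeds) (λ (_ , _ , h) → ¬noPrimeAbove h) ,
  neither (≰⇒≢ (above⇒+≰ n exceeds)) ≢small ,
  neither (above⇒+≰ n exceeds) (¬noPrimeAbove ∘ proj₂) ,
  neither (≰⇒≢ (above⇒+≰ n exceeds)) ≢small ,
  neither (above⇒+≰ n exceeds) (λ (_ , _ , h) → ¬noPrimeAbove h) ,
  neither (≰⇒≢ (above⇒+≰ n exceeds)) ≢small
  where
  rearrange : ∀ n → n + (2 + n) ≡ 2 * (1 + n)
  rearrange = solve-∀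
  exceeds : n + 5 ≤ 2 * (1 + n)
  exceeds = begin
    n + 5         ≤⟨ +-monoʳ-≤ n (s≤s (s≤s (≤-trans (m≤m+n 3 25) large))) ⟩
    n + (2 + n)   ≡⟨ rearrange n ⟩
    2 * (1 + n)   ∎
    where open ≤-Reasoning
  ≢small : ∀ {c} → {T (c <ᵇ 28)} → n ≢ c
  ≢small {c} {c<28} = ≥⇒≢ large {c} {c<28}
  notTwice : ¬ (Σ ℕ λ p → Prime p × 11 ≤ p × n ≡ 2 * p)
  notTwice (p , _ , _ , n≡2p) = odd (subst (2 ∣_) (sym n≡2p) (m∣m*n p))
  ¬noPrime : ¬ (∀ p → Prime p → n ≢ p × n ≢ 2 * p)
  ¬noPrime h = proj₁ (h n pr) refl
  ¬noPrimeAbove : ∀ {b} → {T (b ≤ᵇ 28)} → ¬ (∀ p → Prime p → b ≤ p → n ≢ p × n ≢ 2 * p)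
  ¬noPrimeAbove {b} {b≤28} h = proj₁ (h n pr (≤-trans (≤ᵇ⇒≤ b 28 b≤28) large)) refl

deltaThresholds-twicePrime : ∀ {p} → 14 ≤ p → Prime p → DeltaThresholds (2 * p) (2 + p)
deltaThresholds-twicePrime {p} large pr =
  both (≤-reflexive on) (λ (_ , odd) → odd (m∣m*n p)) ,
  both on (inj₂ (inj₂ (inj₂ (inj₂ (inj₂ (inj₂ (p , pr , ≤-trans (m≤m+n 11 3) large , refl))))))) ,
  neither (above⇒≰+ n exceeds) (¬noPrime ∘ proj₂) ,
  neither (≰⇒≢ (above⇒≰+ n exceeds)) [ ≢small , ≢small ]′ ,
  neither (above⇒≰+ n exceeds) (λ (_ , _ , _ , h) → ¬noPrime h) ,
  neither (≰⇒≢ (above⇒≰+ n exceeds)) ≢small ,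
  neither (above⇒≰+ n exceeds) (λ (_ , _ , _ , _ , h) → ¬noPrime h) ,
  neither (≰⇒≢ (above⇒≰+ n exceeds)) ≢small ,
  neither (above⇒≰ n exceeds) (λ (_ , _ , _ , _ , _ , h) → ¬noPrime h) ,
  neither (≰⇒≢ (above⇒≰ n exceeds)) [ ≢small , ≢small ]′ ,
  neither (above⇒+≰ n exceeds) (¬noPrimeAbove ∘ proj₂) ,
  neither (≰⇒≢ (above⇒+≰ n exceeds)) ≢small ,
  neither (above⇒+≰ n exceeds) (λ (_ , _ , h) → ¬noPrimeAbove h) ,
  neither (≰⇒≢ (above⇒+≰ n exceeds)) ≢small ,
  neither (above⇒+≰ n exceeds) (¬noPrimeAbove ∘ proj₂) ,
  neither (≰⇒≢ (above⇒+≰ n exceeds)) ≢small ,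
  neither (above⇒+≰ n exceeds) (λ (_ , _ , h) → ¬noPrimeAbove h) ,
  neither (≰⇒≢ (above⇒+≰ n exceeds)) ≢small
  where
  n : ℕ
  n = 2 * p
  on : 2 * (2 + p) ≡ n + 4
  on = trans (*-distribˡ-+ 2 2 p) (+-comm 4 n)
  exceeds : n + 4 ≤ 2 * (2 + p)
  exceeds = ≤-reflexive (sym on)
  ≢small : ∀ {c} → {T (c <ᵇ 28)} → n ≢ c
  ≢small {c} {c<28} = ≥⇒≢ (*-monoʳ-≤ 2 large) {c} {c<28}
  ¬noPrime : ¬ (∀ q → Prime q → n ≢ q × n ≢ 2 * q)
  ¬noPrime h = proj₂ (h p pr) refl
  ¬noPrimeAbove : ∀ {b} → {T (b ≤ᵇ 14)} → ¬ (∀ q → Prime q → b ≤ q → n ≢ q × n ≢ 2 * q)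
  ¬noPrimeAbove {b} {b≤14} h = proj₂ (h p pr (≤-trans (≤ᵇ⇒≤ b 14 b≤14) large)) refl

deltaThresholds-composite : ∀ {n d} → 28 ≤ n → ¬ Prime n → (∀ p → Prime p → n ≢ 2 * p) →
  2 * d + 5 ≤ n → DeltaThresholds n d
deltaThresholds-composite {n} {d} large ¬prime ¬twice below =
  both (below⇒≤+ x below) (¬prime ∘ proj₁) ,
  neither (below⇒≢+ x below)
    [ ≢small , [ ≢small , [ ≢small , [ ≢small , [ ≢small , [ ≢small , notTwice ]′ ]′ ]′ ]′ ]′ ]′ ,
  both (below⇒≤+ x below) (≢small , noPrime) ,
  neither (below⇒≢+ x below) [ ≢small , ≢small ]′ ,
  both (below⇒≤+ x below) (≢small , ≢small , ≢small , noPrime) ,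
  neither (below⇒≢+ x below) ≢small ,
  both (below⇒≤+ x below) (≢small , ≢small , ≢small , ≢small , noPrime) ,
  neither (below⇒≢+ x below) ≢small ,
  both (below⇒≤ x below) (≢small , ≢small , ≢small , ≢small , ≢small , noPrime) ,
  neither (below⇒≢ x below) [ ≢small , ≢small ]′ ,
  both (below⇒+≤ x below) (≤-trans (m≤m+n 20 8) large , noPrimeAbove) ,
  neither (below⇒+≢ x below) ≢small ,
  both (below⇒+≤ x below) (≤-trans (m≤m+n 20 8) large , ≢small , noPrimeAbove) ,
  neither (below⇒+≢ x below) ≢small ,
  both (below⇒+≤ x below) (≤-trans (m≤m+n 24 4) large , noPrimeAbove) ,
  neither (below⇒+≢ x below) ≢small ,
  both (below⇒+≤ x below) (≤-trans (m≤m+n 24 4) large , ≢small , noPrimeAbove) ,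
  neither (below⇒+≢ x below) ≢small
  where
  x : ℕ
  x = 2 * d
  ≢small : ∀ {c} → {T (c <ᵇ 28)} → n ≢ c
  ≢small {c} {c<28} = ≥⇒≢ large {c} {c<28}
  noPrime : ∀ p → Prime p → n ≢ p × n ≢ 2 * p
  noPrime p pr = (λ n≡p → ¬prime (subst Prime (sym n≡p) pr)) , ¬twice p pr
  noPrimeAbove : ∀ {b} p → Prime p → b ≤ p → n ≢ p × n ≢ 2 * p
  noPrimeAbove p pr _ = noPrime p pr
  notTwice : ¬ (Σ ℕ λ p → Prime p × 11 ≤ p × n ≡ 2 * p)
  notTwice (p , pr , _ , n≡2p) = ¬twice p pr n≡2p

deltaThresholds-large : ∀ {n r s} → 28 ≤ n → IsDelta n (r + s) → Admissible n r s →
  DeltaThresholds n (r + s)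
deltaThresholds-large {r = 0} large _ (_ , refl) = contradiction large λ ()
deltaThresholds-large {n} {1} {s} large isδ (_ , s+0≡n) =
  subst (λ m → DeltaThresholds n (1 + m)) (sym s≡n) (deltaThresholds-oddPrime large pr odd)
  where
  s≡n : s ≡ n
  s≡n = trans (sym (+-identityʳ s)) s+0≡n
  pr : Prime n
  pr = isDelta-1+n⇒prime (≤-trans (m≤m+n 2 26) large) (subst (λ m → IsDelta n (1 + m)) s≡n isδ)
  odd : ¬ 2 ∣ n
  odd 2∣n = [ (λ ()) , ≥⇒≢ large ∘ sym ]′ (prime⇒irreducible pr 2∣n)
deltaThresholds-large {r = 2} {s} large isδ (_ , refl) =
  deltaThresholds-twicePrime 14≤s (isDelta-2+n⇒prime (≤-trans (m≤m+n 5 9) 14≤s) isδ)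
  where
  14≤s : 14 ≤ s
  14≤s = *-cancelˡ-≤ 2 large
deltaThresholds-large {r = r@(suc (2+ a))} {s@(suc (2+ b))} large isδ
                      (s≤s (s≤s (s≤s a≤b)) , refl) =
  deltaThresholds-composite {d = r + s} large
    (product-¬prime {r} {s} (s≤s (s≤s z≤n)) (s≤s (s≤s z≤n)))
    (λ p → product-≢twicePrime {r} {s} (s≤s (s≤s (s≤s z≤n))) (s≤s (s≤s (s≤s z≤n))))
    (9≤excess⇒below (suc a) (suc b) (isDelta⇒9≤excess (s≤s z≤n) (s≤s a≤b) large isδ))

lemma4p2 : ∀ n → 1 ≤ n → ∀ d → IsDelta n d →
  (2 * d ≤ n + 4 ⇔ (¬ (Prime n × ¬ (2 ∣ n)))) ×
  (2 * d ≡ n + 4 ⇔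
    (n ≡ 2 ⊎ n ≡ 4 ⊎ n ≡ 6 ⊎ n ≡ 8 ⊎ n ≡ 10 ⊎ n ≡ 14 ⊎
     (Σ ℕ λ p → Prime p × 11 ≤ p × n ≡ 2 * p))) ×
  (2 * d ≤ n + 3 ⇔ (n ≢ 8 × (∀ p → Prime p → n ≢ p × n ≢ 2 * p))) ×
  (2 * d ≡ n + 3 ⇔ (n ≡ 1 ⊎ n ≡ 9)) ×
  (2 * d ≤ n + 2 ⇔
    (n ≢ 1 × n ≢ 8 × n ≢ 9 × (∀ p → Prime p → n ≢ p × n ≢ 2 * p))) ×
  (2 * d ≡ n + 2 ⇔ (n ≡ 12)) ×
  (2 * d ≤ n + 1 ⇔
    (n ≢ 1 × n ≢ 8 × n ≢ 9 × n ≢ 12 × (∀ p → Prime p → n ≢ p × n ≢ 2 * p))) ×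
  (2 * d ≡ n + 1 ⇔ (n ≡ 15)) ×
  (2 * d ≤ n ⇔
    (n ≢ 1 × n ≢ 8 × n ≢ 9 × n ≢ 12 × n ≢ 15 ×
     (∀ p → Prime p → n ≢ p × n ≢ 2 * p))) ×
  (2 * d ≡ n ⇔ (n ≡ 16 ⊎ n ≡ 18)) ×
  (2 * d + 1 ≤ n ⇔
    (20 ≤ n × (∀ p → Prime p → 11 ≤ p → n ≢ p × n ≢ 2 * p))) ×
  (2 * d + 1 ≡ n ⇔ (n ≡ 21)) ×
  (2 * d + 2 ≤ n ⇔
    (20 ≤ n × n ≢ 21 × (∀ p → Prime p → 11 ≤ p → n ≢ p × n ≢ 2 * p))) ×
  (2 * d + 2 ≡ n ⇔ (n ≡ 20)) ×
  (2 * d + 3 ≤ n ⇔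
    (24 ≤ n × (∀ p → Prime p → 13 ≤ p → n ≢ p × n ≢ 2 * p))) ×
  (2 * d + 3 ≡ n ⇔ (n ≡ 27)) ×
  (2 * d + 4 ≤ n ⇔
    (24 ≤ n × n ≢ 27 × (∀ p → Prime p → 13 ≤ p → n ≢ p × n ≢ 2 * p))) ×
  (2 * d + 4 ≡ n ⇔ (n ≡ 24))
lemma4p2 n 1≤n _ isδ@((r , s , adm , refl) , _) with n <? 28
... | no  n≮28 = deltaThresholds-large (≮⇒≥ n≮28) isδ adm
... | yes n<28 =
  deltaThresholds-small n<28 1≤n (s≤s (proj₁ bounds)) (s≤s (proj₂ bounds)) adm minimal
  where
  bounds : r ≤ n × s ≤ n
  bounds = admissible⇒≤ 1≤n adm
  minimal : MinimalUpTo n r s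
  minimal {r′} _ {s′} _ (_ , r′s′≡n) = isDelta-≤ isδ r′ s′ r′s′≡n
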